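{- Let $(C_n)_{n\ge0}$ be a sequence satisfying $C_{n+1}=\sum_{k=0}^n C_kS_{n,k}$ for all $n\ge0$, where $S_{n,k}$ are the Stirling numbers of the second kind. Then for all $n\ge0$, \[C_{n+2}=\sum_{k=0}^{n}S_{n,k}\,(C_{k+1}+kC_k).\]
   Context: $S_{n,k}$ is the number of partitions of an $n$-set into $k$ nonempty blocks ($S_{0,0}=1$). The sequence $(C_n)$ is the eigensequence of the Stirling transform; with $C_0=1$ it is $1,1,1,2,6,26,152,1144,\dots$. -}

module Defs where

open import Data.Nat using (ℕ; zero; suc)
open import Data.Integer using (ℤ; +_; _+_; _*_)

S : ℕ → ℕ → ℕ
S zero    zero    = 1
S zero    (suc k) = 0
S (suc n) zero    = 0
S (suc n) (suc k) = suc k Data.Nat.* S n (suc k) Data.Nat.+ S n k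

sumTo : ℕ → (ℕ → ℤ) → ℤ
sumTo zero    f = f zero
sumTo (suc n) f = sumTo n f + f (suc n)

-- The identity holds for every sequence C once C (n+2) is replaced by Σ_k C k S (n+1) k:
-- split S (n+1) (k+1) = (k+1) S n (k+1) + S n k and shift the index of the second part.
module Submission where

open import Defs
open import Data.Nat using (ℕ; suc; zero; _<_; s≤s)
import Data.Nat as ℕ
import Data.Nat.Properties as ℕₚ
open import Data.Integer using (ℤ; +_; _+_; _*_)
import Data.Integer.Properties as ℤₚ
open import Data.Integer.Tactic.RingSolver using (solve-∀)
open import Function using (_∘_)
open import Relation.Binary.PropositionalEquality
  using (_≡_; refl; sym; trans; cong; cong₂; module ≡-Reasoning)

sumTo-cong : ∀ n {f g : ℕ → ℤ} → (∀ k → f k ≡ g k) → sumTo n f ≡ sumTo n g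
sumTo-cong zero    f≗g = f≗g zero
sumTo-cong (suc n) f≗g = cong₂ _+_ (sumTo-cong n f≗g) (f≗g (suc n))

sumTo-distrib-+ : ∀ n (f g : ℕ → ℤ) →
  sumTo n (λ k → f k + g k) ≡ sumTo n f + sumTo n g
sumTo-distrib-+ zero    f g = refl
sumTo-distrib-+ (suc n) f g =
  trans (cong (_+ (f (suc n) + g (suc n))) (sumTo-distrib-+ n f g))
        (interchange (sumTo n f) (sumTo n g) (f (suc n)) (g (suc n)))
  where
  interchange : ∀ a b c d → (a + b) + (c + d) ≡ (a + c) + (b + d)
  interchange = solve-∀

sumTo-suc : ∀ n (f : ℕ → ℤ) → sumTo (suc n) f ≡ f 0 + sumTo n (f ∘ suc)
sumTo-suc zero    f = refl
sumTo-suc (suc n) f =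
  trans (cong (_+ f (suc (suc n))) (sumTo-suc n f)) (ℤₚ.+-assoc (f 0) _ _)

sumTo-shift : ∀ n (f : ℕ → ℤ) → f 0 ≡ + 0 → f (suc n) ≡ + 0 →
  sumTo n (f ∘ suc) ≡ sumTo n f
sumTo-shift n f f0≡0 fn+1≡0 = begin
  sumTo n (f ∘ suc)         ≡⟨ sym (ℤₚ.+-identityˡ _) ⟩
  + 0 + sumTo n (f ∘ suc)   ≡⟨ cong (_+ sumTo n (f ∘ suc)) (sym f0≡0) ⟩
  f 0 + sumTo n (f ∘ suc)   ≡⟨ sym (sumTo-suc n f) ⟩
  sumTo n f + f (suc n)     ≡⟨ cong (λ x → sumTo n f + x) fn+1≡0 ⟩
  sumTo n f + + 0           ≡⟨ ℤₚ.+-identityʳ _ ⟩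
  sumTo n f                 ∎
  where open ≡-Reasoning

S-vanishes-above : ∀ {n k} → n < k → S n k ≡ 0
S-vanishes-above {zero}  {suc k} _ = refl
S-vanishes-above {suc n} {suc k} (s≤s n<k)
  rewrite S-vanishes-above (ℕₚ.m<n⇒m<1+n n<k) | S-vanishes-above n<k =
  trans (ℕₚ.+-identityʳ _) (ℕₚ.*-zeroʳ k)

S-suc-weighted : ∀ n j (c : ℤ) →
  c * + S (suc n) (suc j) ≡ + S n j * c + + S n (suc j) * (+ suc j * c)
S-suc-weighted n j c = begin
  c * + S (suc n) (suc j)
    ≡⟨ cong (c *_) (ℤₚ.pos-+ (suc j ℕ.* S n (suc j)) (S n j)) ⟩
  c * (+ (suc j ℕ.* S n (suc j)) + + S n j)
    ≡⟨ cong (λ x → c * (x + + S n j)) (ℤₚ.pos-* (suc j) (S n (suc j))) ⟩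
  c * (+ suc j * + S n (suc j) + + S n j)
    ≡⟨ rearrange c (+ suc j) (+ S n (suc j)) (+ S n j) ⟩
  + S n j * c + + S n (suc j) * (+ suc j * c) ∎
  where
  open ≡-Reasoning
  rearrange : ∀ c s a b → c * (s * a + b) ≡ b * c + a * (s * c)
  rearrange = solve-∀

stirling-transform-suc : ∀ (c : ℕ → ℤ) n →
  sumTo (suc n) (λ k → c k * + S (suc n) k) ≡
  sumTo n (λ k → + S n k * (c (suc k) + + k * c k))
stirling-transform-suc c n = begin
  sumTo (suc n) (λ k → c k * + S (suc n) k)
    ≡⟨ sumTo-suc n _ ⟩
  c 0 * + 0 + sumTo n (λ j → c (suc j) * + S (suc n) (suc j))
    ≡⟨ cong (_+ sumTo n (λ j → c (suc j) * + S (suc n) (suc j))) (ℤₚ.*-zeroʳ (c 0)) ⟩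
  + 0 + sumTo n (λ j → c (suc j) * + S (suc n) (suc j))
    ≡⟨ ℤₚ.+-identityˡ _ ⟩
  sumTo n (λ j → c (suc j) * + S (suc n) (suc j))
    ≡⟨ sumTo-cong n (λ j → S-suc-weighted n j (c (suc j))) ⟩
  sumTo n (λ j → a j + g (suc j))
    ≡⟨ sumTo-distrib-+ n a (g ∘ suc) ⟩
  sumTo n a + sumTo n (g ∘ suc)
    ≡⟨ cong (λ x → sumTo n a + x) (sumTo-shift n g (ℤₚ.*-zeroʳ (+ S n 0)) g[n+1]≡0) ⟩
  sumTo n a + sumTo n g
    ≡⟨ sym (sumTo-distrib-+ n a g) ⟩
  sumTo n (λ k → a k + g k)
    ≡⟨ sumTo-cong n (λ k → sym (ℤₚ.*-distribˡ-+ (+ S n k) (c (suc k)) (+ k * c k))) ⟩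
  sumTo n (λ k → + S n k * (c (suc k) + + k * c k)) ∎
  where
  open ≡-Reasoning
  a g : ℕ → ℤ
  a k = + S n k * c (suc k)
  g k = + S n k * (+ k * c k)
  g[n+1]≡0 : g (suc n) ≡ + 0
  g[n+1]≡0 rewrite S-vanishes-above (ℕₚ.n<1+n n) = refl

proposition12 : (C : ℕ → ℤ) →
    (∀ n → C (suc n) ≡ sumTo n (λ k → C k * + S n k)) →
    ∀ n → C (suc (suc n)) ≡ sumTo n (λ k → + S n k * (C (suc k) + + k * C k))
proposition12 C eigen n = trans (eigen (suc n)) (stirling-transform-suc C n)
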